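{- Let $n\ge1$, $p=n+1$, and $\varphi:\mathbb{Z}_{n^2}\to\mathbb{Z}_{n^2}$, $\varphi(i)=ip \bmod n^2$. For $t,g\in\mathbb{Z}_n$, let Block $t$ be the set of positions $\{tn,tn+1,\dots,tn+n-1\}\subseteq\mathbb{Z}_{n^2}$ and Group $g$ be the set $\{\varphi(gn),\varphi(gn+1),\dots,\varphi(gn+n-1)\}\subseteq\mathbb{Z}_{n^2}$. Then for every $t,g\in\mathbb{Z}_n$ there exists a unique position $f(t,g)\in\mathbb{Z}_{n^2}$ lying in both Block $t$ and Group $g$, and the map $f:\mathbb{Z}_n^2\to\mathbb{Z}_{n^2}$ is a bijection. -}

module Defs where

open import Data.Nat using (ℕ; suc; _+_; _*_; _%_)
open import Data.Fin using (Fin; toℕ)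
open import Data.Product using (∃)
open import Relation.Binary.PropositionalEquality using (_≡_)

-- Throughout, n = suc m (so n ≥ 1), ℤ_n = Fin n, ℤ_{n²} = Fin (n * n),
-- elements identified with their representatives 0..n-1 resp. 0..n²-1.

φ : (m : ℕ) → ℕ → ℕ
φ m i = (i * (suc m + 1)) % (suc m * suc m)

InBlock : (m : ℕ) → Fin (suc m) → Fin (suc m * suc m) → Set
InBlock m t x = ∃ λ (j : Fin (suc m)) → toℕ x ≡ toℕ t * suc m + toℕ j

InGroup : (m : ℕ) → Fin (suc m) → Fin (suc m * suc m) → Set
InGroup m g x = ∃ λ (j : Fin (suc m)) → toℕ x ≡ φ m (toℕ g * suc m + toℕ j)

{-# OPTIONS --safe #-}
module Submission where

-- Write positions of ℤ_{n²} as combine t j = t·n + j. Since (gn + j)(n + 1) = (g + j)n + j + g·n²,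
-- φ(gn + j) = ((g + j) mod n)·n + j, so Group g = {combine (g + j) j : j ∈ ℤ_n}. This meets
-- Block t = {combine t j : j ∈ ℤ_n} exactly where g + j = t, i.e. j = t − g. Hence
-- f(t, g) = combine t (t − g), which is the bijection combine after the involution (t, g) ↦ (t, t − g).

open import Defs
open import Data.Nat using (ℕ; suc; _*_)
open import Data.Fin using (Fin)
open import Data.Product using (Σ; _×_; uncurry)
open import Function.Definitions using (Bijective)
open import Relation.Binary.PropositionalEquality using (_≡_)

open import Data.Nat using (NonZero; _+_; _∸_; _%_; _≤_; _<_)
open import Data.Nat.Properties using (+-comm; +-assoc; *-comm; m+[n∸m]≡n; <⇒≤)
open import Data.Nat.DivMod
open import Data.Nat.Tactic.RingSolver using (solve-∀)
open import Data.Fin using (toℕ; combine)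
open import Data.Fin.Properties using (toℕ-injective; toℕ<n; toℕ-fromℕ<; toℕ-combine; combine-injective; *↔×)
open import Data.Product using (_,_; ∃)
open import Function using (_↔_; mk↔ₛ′; Bijection)
open import Function.Properties.Inverse using (↔-sym; ↔-trans; ↔⇒⤖)
open import Relation.Binary.PropositionalEquality using (refl; sym; trans; cong; subst; module ≡-Reasoning)
open ≡-Reasoning

[m%d+n]%d≡[m+n]%d : ∀ m n d .{{_ : NonZero d}} → (m % d + n) % d ≡ (m + n) % d
[m%d+n]%d≡[m+n]%d m n d = begin
  (m % d + n) % d          ≡⟨ %-distribˡ-+ (m % d) n d ⟩
  (m % d % d + n % d) % d  ≡⟨ cong (λ k → (k + n % d) % d) (m%n%n≡m%n m d) ⟩
  (m % d + n % d) % d      ≡⟨ %-distribˡ-+ m n d ⟨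
  (m + n) % d              ∎

[m+n%d]%d≡[m+n]%d : ∀ m n d .{{_ : NonZero d}} → (m + n % d) % d ≡ (m + n) % d
[m+n%d]%d≡[m+n]%d m n d = begin
  (m + n % d) % d  ≡⟨ cong (_% d) (+-comm m (n % d)) ⟩
  (n % d + m) % d  ≡⟨ [m%d+n]%d≡[m+n]%d n m d ⟩
  (n + m) % d      ≡⟨ cong (_% d) (+-comm n m) ⟩
  (m + n) % d      ∎

[m+n+[d∸m]]%d≡n%d : ∀ m n d .{{_ : NonZero d}} → m ≤ d → (m + n + (d ∸ m)) % d ≡ n % d
[m+n+[d∸m]]%d≡n%d m n d m≤d = begin
  (m + n + (d ∸ m)) % d    ≡⟨ cong (λ k → (k + (d ∸ m)) % d) (+-comm m n) ⟩
  (n + m + (d ∸ m)) % d    ≡⟨ cong (_% d) (+-assoc n m (d ∸ m)) ⟩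
  (n + (m + (d ∸ m))) % d  ≡⟨ cong (λ k → (n + k) % d) (m+[n∸m]≡n m≤d) ⟩
  (n + d) % d              ≡⟨ [m+n]%n≡m%n n d ⟩
  n % d                    ∎

module _ {n : ℕ} .{{_ : NonZero n}} where

  infixl 6 _⊕_ _⊖_

  _⊕_ : Fin n → Fin n → Fin n
  i ⊕ j = (toℕ i + toℕ j) mod n

  _⊖_ : Fin n → Fin n → Fin n
  i ⊖ j = (toℕ i + (n ∸ toℕ j)) mod n

  toℕ-mod : ∀ k → toℕ (k mod n) ≡ k % n
  toℕ-mod k = toℕ-fromℕ< (m%n<n k n)

  ⊕-comm : ∀ i j → i ⊕ j ≡ j ⊕ i
  ⊕-comm i j = cong (_mod n) (+-comm (toℕ i) (toℕ j))

  i⊕[j⊖i]≡j : ∀ i j → i ⊕ (j ⊖ i) ≡ j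
  i⊕[j⊖i]≡j i j = toℕ-injective (begin
    toℕ (i ⊕ (j ⊖ i))                        ≡⟨ toℕ-mod (toℕ i + toℕ (j ⊖ i)) ⟩
    (toℕ i + toℕ (j ⊖ i)) % n                ≡⟨ cong (λ k → (toℕ i + k) % n) (toℕ-mod (toℕ j + (n ∸ toℕ i))) ⟩
    (toℕ i + (toℕ j + (n ∸ toℕ i)) % n) % n  ≡⟨ [m+n%d]%d≡[m+n]%d (toℕ i) _ n ⟩
    (toℕ i + (toℕ j + (n ∸ toℕ i))) % n      ≡⟨ cong (_% n) (+-assoc (toℕ i) (toℕ j) _) ⟨
    (toℕ i + toℕ j + (n ∸ toℕ i)) % n        ≡⟨ [m+n+[d∸m]]%d≡n%d (toℕ i) (toℕ j) n (<⇒≤ (toℕ<n i)) ⟩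
    toℕ j % n                                ≡⟨ m<n⇒m%n≡m (toℕ<n j) ⟩
    toℕ j                                    ∎)

  [i⊕j]⊖i≡j : ∀ i j → (i ⊕ j) ⊖ i ≡ j
  [i⊕j]⊖i≡j i j = toℕ-injective (begin
    toℕ (i ⊕ j ⊖ i)                          ≡⟨ toℕ-mod (toℕ (i ⊕ j) + (n ∸ toℕ i)) ⟩
    (toℕ (i ⊕ j) + (n ∸ toℕ i)) % n          ≡⟨ cong (λ k → (k + (n ∸ toℕ i)) % n) (toℕ-mod (toℕ i + toℕ j)) ⟩
    ((toℕ i + toℕ j) % n + (n ∸ toℕ i)) % n  ≡⟨ [m%d+n]%d≡[m+n]%d (toℕ i + toℕ j) _ n ⟩
    (toℕ i + toℕ j + (n ∸ toℕ i)) % n        ≡⟨ [m+n+[d∸m]]%d≡n%d (toℕ i) (toℕ j) n (<⇒≤ (toℕ<n i)) ⟩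
    toℕ j % n                                ≡⟨ m<n⇒m%n≡m (toℕ<n j) ⟩
    toℕ j                                    ∎)

  i⊖[i⊖j]≡j : ∀ i j → i ⊖ (i ⊖ j) ≡ j
  i⊖[i⊖j]≡j i j = begin
    i ⊖ (i ⊖ j)            ≡⟨ cong (_⊖ (i ⊖ j)) (trans (⊕-comm (i ⊖ j) j) (i⊕[j⊖i]≡j j i)) ⟨
    (i ⊖ j) ⊕ j ⊖ (i ⊖ j)  ≡⟨ [i⊕j]⊖i≡j (i ⊖ j) j ⟩
    j                      ∎

  shear : Fin n × Fin n → Fin n × Fin n
  shear (i , j) = i , i ⊖ j

  shear-involutive : ∀ p → shear (shear p) ≡ p
  shear-involutive (i , j) = cong (i ,_) (i⊖[i⊖j]≡j i j)

  shear↔ : (Fin n × Fin n) ↔ (Fin n × Fin n)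
  shear↔ = mk↔ₛ′ shear shear shear-involutive shear-involutive

toℕ-combine′ : ∀ {k n} (i : Fin k) (j : Fin n) → toℕ (combine i j) ≡ toℕ i * n + toℕ j
toℕ-combine′ {n = n} i j = trans (toℕ-combine i j) (cong (_+ toℕ j) (*-comm n (toℕ i)))

module _ (m : ℕ) where

  private
    N : ℕ
    N = suc m

  φ[g*n+j]≡[g+j]%n*n+j : ∀ g j → j < N → φ m (g * N + j) ≡ (g + j) % N * N + j
  φ[g*n+j]≡[g+j]%n*n+j g j j<N = begin
    (g * N + j) * (N + 1) % (N * N)           ≡⟨ cong (_% (N * N)) (expand g j N) ⟩
    ((g + j) * N + j + g * (N * N)) % (N * N) ≡⟨ [m+kn]%n≡m%n ((g + j) * N + j) g (N * N) ⟩
    ((g + j) * N + j) % (N * N)               ≡⟨ [m*n+o]%[p*n]≡[m*n]%[p*n]+o (g + j) N j<N ⟩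
    (g + j) * N % (N * N) + j                 ≡⟨ cong (_+ j) (m%n*o≡m*o%[n*o] (g + j) N N) ⟨
    (g + j) % N * N + j                       ∎
    where
    expand : ∀ g j n → (g * n + j) * (n + 1) ≡ (g + j) * n + j + g * (n * n)
    expand = solve-∀

  φ-combine : ∀ (g j : Fin N) → φ m (toℕ g * N + toℕ j) ≡ toℕ (combine (g ⊕ j) j)
  φ-combine g j = begin
    φ m (toℕ g * N + toℕ j)               ≡⟨ φ[g*n+j]≡[g+j]%n*n+j (toℕ g) (toℕ j) (toℕ<n j) ⟩
    (toℕ g + toℕ j) % N * N + toℕ j       ≡⟨ cong (λ k → k * N + toℕ j) (toℕ-mod (toℕ g + toℕ j)) ⟨
    toℕ (g ⊕ j) * N + toℕ j               ≡⟨ toℕ-combine′ (g ⊕ j) j ⟨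
    toℕ (combine (g ⊕ j) j)               ∎

  combine∈Block : ∀ t j → InBlock m t (combine t j)
  combine∈Block t j = j , toℕ-combine′ t j

  Block⇒combine : ∀ t {x} → InBlock m t x → ∃ λ j → x ≡ combine t j
  Block⇒combine t (j , eq) = j , toℕ-injective (trans eq (sym (toℕ-combine′ t j)))

  combine∈Group : ∀ g j → InGroup m g (combine (g ⊕ j) j)
  combine∈Group g j = j , sym (φ-combine g j)

  Group⇒combine : ∀ g {x} → InGroup m g x → ∃ λ j → x ≡ combine (g ⊕ j) j
  Group⇒combine g (j , eq) = j , toℕ-injective (trans eq (φ-combine g j))

  intersection : Fin N → Fin N → Fin (N * N)
  intersection t g = combine t (t ⊖ g)

  intersection∈Block : ∀ t g → InBlock m t (intersection t g)
  intersection∈Block t g = combine∈Block t (t ⊖ g)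

  intersection∈Group : ∀ t g → InGroup m g (intersection t g)
  intersection∈Group t g =
    subst (λ s → InGroup m g (combine s (t ⊖ g))) (i⊕[j⊖i]≡j g t) (combine∈Group g (t ⊖ g))

  intersection-unique : ∀ t g x → InBlock m t x → InGroup m g x → x ≡ intersection t g
  intersection-unique t g x x∈B x∈G
    with j , refl ← Block⇒combine t x∈B | k , eq ← Group⇒combine g x∈G
    with refl , refl ← combine-injective t j (g ⊕ k) k eq
    = cong (combine t) (sym ([i⊕j]⊖i≡j g k))

  intersection-bijective : Bijective _≡_ _≡_ (uncurry intersection)
  intersection-bijective = Bijection.bijective (↔⇒⤖ (↔-trans shear↔ (↔-sym *↔×)))

lemma4 : (m : ℕ) →
    Σ (Fin (suc m) → Fin (suc m) → Fin (suc m * suc m)) λ f →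
      ((t g : Fin (suc m)) →
        InBlock m t (f t g) × InGroup m g (f t g) ×
        ((x : Fin (suc m * suc m)) → InBlock m t x → InGroup m g x → x ≡ f t g))
      × Bijective _≡_ _≡_ (uncurry f)
lemma4 m =
  intersection m ,
  (λ t g → intersection∈Block m t g , intersection∈Group m t g , intersection-unique m t g) ,
  intersection-bijective m
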